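{- For any graph $G$, each of its associated functions $f_k$ and $F_k$ is a homomorphism.
   Context: All graphs are finite, nonempty and reflexive (every vertex adjacent to itself). For distinct vertices $v,w$ of a graph $H$, $w$ strictly corners $v$ in $H$ if every vertex of $H$ adjacent to $v$ is adjacent to $w$ and some vertex of $H$ adjacent to $w$ is not adjacent to $v$; a strict corner of $H$ is a vertex strictly cornered in $H$ by another vertex. Corner ranking: $G_1=G$, $k=1$. If $G_k$ is a clique, its vertices get rank $k$; stop. Else if $G_k$ has no strict corners, its vertices get rank $\infty$; stop. Else the set $X$ of strict corners of $G_k$ gets rank $k$, $G_{k+1}=G_k-X$, increase $k$, repeat. $\mathrm{cr}(v)$ is the rank of $v$. Functions: for each $k$ with $G_{k+1}$ defined, $f_k$ maps nonempty subsets of $V(G_k)$ to nonempty subsets of $V(G_{k+1})$ by $f_k(\{u\})=\{u\}$ if $\mathrm{cr}(u)>k$, and otherwise $f_k(\{u\})$ = the set of vertices of $G_{k+1}$ that strictly corner $u$ in $G_k$; $f_k(S)=\bigcup_{u\in S}f_k(\{u\})$. $F_1$ is the identity on nonempty subsets of $V(G)$ and $F_k=f_{k-1}\circ\cdots\circ f_1$ (mapping to subsets of $V(G_k)$); if $\mathrm{cr}(G)=\infty$ and $\gamma$ is the largest finite rank present, $F_\infty=f_\gamma\circ\cdots\circ f_1$, and if there is no vertex of finite rank, $F_\infty$ is the identity. Write $h(u)=h(\{u\})$. A function $h$ from nonempty subsets of $V(H)$ to nonempty subsets of $V(G')$ is a homomorphism if for all vertices $u,v$ of $H$ and all $u^*\in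 h(u)$, $v^*\in h(v)$: $u$ adjacent to $v$ implies $u^*$ adjacent to $v^*$. -}

module Defs where

open import Data.Nat using (ℕ; zero; suc)
open import Data.Bool using (Bool; true; false; _∧_; _∨_; not; if_then_else_)
open import Data.Fin using (Fin; _≟_)
open import Data.List.Base using (allFin)
open import Data.Bool.ListAction using (all; any)
open import Data.Product using (Σ; _×_)
open import Relation.Nullary.Decidable using (⌊_⌋)
open import Relation.Binary.PropositionalEquality using (_≡_)

record Graph : Set where
  field
    n     : ℕ
    adj   : Fin (suc n) → Fin (suc n) → Bool
    reflx : ∀ v → adj v v ≡ true
    symm  : ∀ u v → adj u v ≡ adj v u

module _ (G : Graph) where
  open Graph G

  V : Set
  V = Fin (suc n)

  -- subsets of V(G) (used for vertex sets of induced subgraphs G_k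
  -- and for values h({u}) of set-functions)
  Sub : Set
  Sub = V → Bool

  full : Sub
  full _ = true

  allV : (V → Bool) → Bool
  allV p = all p (allFin (suc n))

  anyV : (V → Bool) → Bool
  anyV p = any p (allFin (suc n))

  -- w strictly corners v in the induced subgraph G[S] (both in S, distinct)
  corners : Sub → V → V → Bool
  corners S v w =
    S v ∧ S w ∧ not ⌊ v ≟ w ⌋
    ∧ allV (λ x → not (S x ∧ adj x v) ∨ adj x w)
    ∧ anyV (λ x → S x ∧ adj x w ∧ not (adj x v))

  isStrictCorner : Sub → V → Bool
  isStrictCorner S v = anyV (λ w → corners S v w)

  isClique : Sub → Bool
  isClique S = allV (λ u → allV (λ v → not (S u ∧ S v) ∨ adj u v))

  continues : Sub → Bool
  continues S = not (isClique S) ∧ anyV (isStrictCorner S)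

  removeCorners : Sub → Sub
  removeCorners S v = S v ∧ not (isStrictCorner S v)

  -- Gk k = vertex set of G_k (k ≥ 1; Gk 0 is a dummy value)
  Gk : ℕ → Sub
  Gk zero = full
  Gk (suc zero) = full
  Gk (suc (suc i)) = removeCorners (Gk (suc i))

  Gdef : ℕ → Bool
  Gdef zero = false
  Gdef (suc zero) = true
  Gdef (suc (suc i)) = Gdef (suc i) ∧ continues (Gk (suc i))

  -- f k u = f_k({u}), as a subset of V(G_{k+1}).
  -- For u ∈ V(G_k): cr(u) > k iff u ∈ V(G_{k+1}).
  f : ℕ → V → Sub
  f k u w = Gk (suc k) w ∧
            (if Gk (suc k) u then ⌊ u ≟ w ⌋ else corners (Gk k) u w)

  -- F k u = F_k({u}), as a subset of V(G_k); F_{k+1} = f_k ∘ F_k,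
  -- where f_k(S) is the union of f_k({x}) over x ∈ S.
  F : ℕ → V → Sub
  F zero u w = ⌊ u ≟ w ⌋
  F (suc zero) u w = ⌊ u ≟ w ⌋
  F (suc (suc i)) u w = anyV (λ x → F (suc i) u x ∧ f (suc i) x w)

  -- h (given by its values on singletons, h(S) = ⋃_{u∈S} h({u})) is a map
  -- from nonempty subsets of V(H) to nonempty subsets of V(G'), and is a
  -- homomorphism H → G'.  H and G' are induced subgraphs of G.
  IsHom : Sub → Sub → (V → Sub) → Set
  IsHom H G' h =
    (∀ u → H u ≡ true → Σ V (λ w → h u w ≡ true))
    × (∀ u → H u ≡ true → ∀ w → h u w ≡ true → G' w ≡ true)
    × (∀ u v → H u ≡ true → H v ≡ true → adj u v ≡ true →
         ∀ u* v* → h u u* ≡ true → h v v* ≡ true → adj u* v* ≡ true)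

-- A vertex w that strictly corners v dominates it: every neighbour of v in the current graph
-- is a neighbour of w.  Following strict corners from a removed vertex u cannot go on forever,
-- since the set of non-neighbours of the current vertex shrinks strictly, so it ends at a
-- surviving vertex w'.  Domination is transitive, and a vertex adjacent to the first corner
-- but not to u is also adjacent to w', so w' strictly corners u.  Thus f_k maps every vertex
-- to a nonempty set of vertices dominating it; and if u ~ v, u* dominates u and v* dominates
-- v, then u ~ v* and hence u* ~ v*.  F_k is a composite of such maps and the identity.
module Submission where

open import Defs
open import Data.Nat using (ℕ; zero; suc; _≤_; _<_)
open import Data.Nat.Induction using (<-wellFounded)
open import Data.Bool using (Bool; true; false; _∧_; _∨_; not; if_then_else_)
open import Data.Bool.Properties using (T-≡; not-injective)
open import Data.Fin using (Fin; _≟_)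
open import Data.Fin.Subset using (Subset; _∈_; _⊂_; ∣_∣)
open import Data.Fin.Subset.Properties using (p⊂q⇒∣p∣<∣q∣)
open import Data.Vec.Base using (tabulate)
open import Data.Vec.Properties using (lookup∘tabulate; lookup⇒[]=; []=⇒lookup)
open import Data.List.Base using (allFin)
open import Data.List.Membership.Propositional using (lose)
open import Data.List.Membership.Propositional.Properties using (∈-allFin)
import Data.List.Relation.Unary.All as All
open import Data.List.Relation.Unary.All.Properties using (all⁺; all⁻)
open import Data.List.Relation.Unary.Any using (satisfied)
open import Data.List.Relation.Unary.Any.Properties using (any⁺; any⁻)
open import Data.Product using (∃; _×_; _,_; proj₁; proj₂)
open import Function.Bundles using (Equivalence)
open import Induction.WellFounded using (Acc; acc)
open import Relation.Nullary.Decidable using (⌊_⌋; toWitness; fromWitness; toWitnessFalse; fromWitnessFalse)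
open import Relation.Binary.PropositionalEquality using (_≡_; _≢_; refl; sym; trans; cong; cong₂; subst; subst₂)

open Equivalence using (to; from)

∧-true⁻ : ∀ a {b} → a ∧ b ≡ true → a ≡ true × b ≡ true
∧-true⁻ true p = refl , p

∧-true⁺ : ∀ {a b} → a ≡ true → b ≡ true → a ∧ b ≡ true
∧-true⁺ = cong₂ _∧_

⇒-true⁻ : ∀ {a b c} → not (a ∧ b) ∨ c ≡ true → a ≡ true → b ≡ true → c ≡ true
⇒-true⁻ h refl refl = h

⇒-true⁺ : ∀ {a b c} → (a ≡ true → b ≡ true → c ≡ true) → not (a ∧ b) ∨ c ≡ true
⇒-true⁺ {true}  {true}  h = h refl refl
⇒-true⁺ {true}  {false} h = refl
⇒-true⁺ {false}         h = refl

true≢false : true ≢ false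
true≢false ()

contraposeᵇ : ∀ {a b} → (a ≡ true → b ≡ true) → b ≡ false → a ≡ false
contraposeᵇ {false} _ _    = refl
contraposeᵇ {true}  f b≡ff = trans (sym (f refl)) b≡ff

≟-refl : ∀ {m} (u : Fin m) → ⌊ u ≟ u ⌋ ≡ true
≟-refl u = to T-≡ (fromWitness {a? = u ≟ u} refl)

≟-true⁻ : ∀ {m} {u w : Fin m} → ⌊ u ≟ w ⌋ ≡ true → u ≡ w
≟-true⁻ {u = u} {w} p = toWitness {a? = u ≟ w} (from T-≡ p)

≟-false⁻ : ∀ {m} {u w : Fin m} → not ⌊ u ≟ w ⌋ ≡ true → u ≢ w
≟-false⁻ {u = u} {w} p = toWitnessFalse {a? = u ≟ w} (from T-≡ p)

≟-false⁺ : ∀ {m} {u w : Fin m} → u ≢ w → not ⌊ u ≟ w ⌋ ≡ true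
≟-false⁺ {u = u} {w} u≢w = to T-≡ (fromWitnessFalse {a? = u ≟ w} u≢w)

module _ (G : Graph) where
  open Graph G

  allV-true⁻ : ∀ {p} → allV G p ≡ true → ∀ x → p x ≡ true
  allV-true⁻ {p} h x = to T-≡ (All.lookup (all⁺ p (allFin (suc n)) (from T-≡ h)) (∈-allFin x))

  allV-true⁺ : ∀ {p} → (∀ x → p x ≡ true) → allV G p ≡ true
  allV-true⁺ {p} h = to T-≡ (all⁻ p {xs = allFin (suc n)} (All.tabulate λ {x} _ → from T-≡ (h x)))

  anyV-true⁻ : ∀ {p} → anyV G p ≡ true → ∃ λ x → p x ≡ true
  anyV-true⁻ {p} h with x , px ← satisfied (any⁻ p (allFin (suc n)) (from T-≡ h)) = x , to T-≡ px

  anyV-true⁺ : ∀ {p} x → p x ≡ true → anyV G p ≡ true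
  anyV-true⁺ {p} x px = to T-≡ (any⁺ p (lose {xs = allFin (suc n)} (∈-allFin x) (from T-≡ px)))

  Dominates : Sub G → V G → V G → Set
  Dominates S v w = ∀ x → S x ≡ true → adj x v ≡ true → adj x w ≡ true

  Dominates-refl : ∀ {S v} → Dominates S v v
  Dominates-refl _ _ x~v = x~v

  Dominates-trans : ∀ {S u v w} → Dominates S u v → Dominates S v w → Dominates S u w
  Dominates-trans u⊑v v⊑w x x∈S x~u = v⊑w x x∈S (u⊑v x x∈S x~u)

  dominators-adjacent : ∀ {S u v u* v*} → S u ≡ true → S v* ≡ true → adj u v ≡ true →
                        Dominates S u u* → Dominates S v v* → adj u* v* ≡ true
  dominators-adjacent {u = u} {u* = u*} {v*} u∈S v*∈S u~v u⊑u* v⊑v* =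
    let u~v* = v⊑v* u u∈S u~v
        v*~u* = u⊑u* v* v*∈S (trans (symm v* u) u~v*)
    in trans (symm u* v*) v*~u*

  record StrictlyCorners (S : Sub G) (v w : V G) : Set where
    field
      v∈S         : S v ≡ true
      w∈S         : S w ≡ true
      v≢w         : v ≢ w
      dominates   : Dominates S v w
      separator   : V G
      separator∈S : S separator ≡ true
      separator~w : adj separator w ≡ true
      separator≁v : adj separator v ≡ false

  corners⇒StrictlyCorners : ∀ {S v w} → corners G S v w ≡ true → StrictlyCorners S v w
  corners⇒StrictlyCorners {S} {v} {w} h =
    let v∈S , h₁     = ∧-true⁻ (S v) h
        w∈S , h₂     = ∧-true⁻ (S w) h₁
        v≢w , h₃     = ∧-true⁻ (not ⌊ v ≟ w ⌋) h₂
        v⊑w , sep    = ∧-true⁻ (allV G λ x → not (S x ∧ adj x v) ∨ adj x w) h₃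
        x , x-sep    = anyV-true⁻ sep
        x∈S , x-adj  = ∧-true⁻ (S x) x-sep
        x~w , x≁v    = ∧-true⁻ (adj x w) x-adj
    in record
      { v∈S = v∈S ; w∈S = w∈S ; v≢w = ≟-false⁻ v≢w
      ; dominates = λ y → ⇒-true⁻ (allV-true⁻ v⊑w y)
      ; separator = x ; separator∈S = x∈S ; separator~w = x~w
      ; separator≁v = not-injective x≁v
      }

  StrictlyCorners⇒corners : ∀ {S v w} → StrictlyCorners S v w → corners G S v w ≡ true
  StrictlyCorners⇒corners c =
    ∧-true⁺ v∈S (∧-true⁺ w∈S (∧-true⁺ (≟-false⁺ v≢w)
      (∧-true⁺ (allV-true⁺ λ x → ⇒-true⁺ (dominates x))
               (anyV-true⁺ separator (∧-true⁺ separator∈S (∧-true⁺ separator~w (cong not separator≁v)))))))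
    where open StrictlyCorners c

  isStrictCorner-true⁻ : ∀ {S v} → isStrictCorner G S v ≡ true → ∃ λ w → StrictlyCorners S v w
  isStrictCorner-true⁻ h with w , c ← anyV-true⁻ h = w , corners⇒StrictlyCorners c

  removeCorners-true⁻ : ∀ {S v} → removeCorners G S v ≡ true → S v ≡ true
  removeCorners-true⁻ {S} {v} h = proj₁ (∧-true⁻ (S v) h)

  removeCorners-true⁺ : ∀ {S v} → S v ≡ true → isStrictCorner G S v ≡ false → removeCorners G S v ≡ true
  removeCorners-true⁺ v∈S not-corner = ∧-true⁺ v∈S (cong not not-corner)

  removeCorners-false⁻ : ∀ {S v} → S v ≡ true → removeCorners G S v ≡ false → isStrictCorner G S v ≡ true
  removeCorners-false⁻ {S} {v} v∈S h =
    not-injective (trans (sym (cong (_∧ not (isStrictCorner G S v)) v∈S)) h)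

  isNonNeighbour : Sub G → V G → V G → Bool
  isNonNeighbour S w x = S x ∧ not (adj x w)

  nonNeighbours : Sub G → V G → Subset (suc n)
  nonNeighbours S w = tabulate (isNonNeighbour S w)

  ∈-nonNeighbours⁻ : ∀ {S w x} → x ∈ nonNeighbours S w → S x ≡ true × adj x w ≡ false
  ∈-nonNeighbours⁻ {S} {w} {x} x∈N =
    let x∈S , x≁w = ∧-true⁻ (S x) (trans (sym (lookup∘tabulate (isNonNeighbour S w) x)) ([]=⇒lookup x∈N))
    in x∈S , not-injective x≁w

  ∈-nonNeighbours⁺ : ∀ {S w x} → S x ≡ true → adj x w ≡ false → x ∈ nonNeighbours S w
  ∈-nonNeighbours⁺ {S} {w} {x} x∈S x≁w =
    lookup⇒[]= x _ (trans (lookup∘tabulate (isNonNeighbour S w) x) (∧-true⁺ x∈S (cong not x≁w)))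

  StrictlyCorners⇒nonNeighbours-⊂ : ∀ {S v w} → StrictlyCorners S v w →
                                     nonNeighbours S w ⊂ nonNeighbours S v
  StrictlyCorners⇒nonNeighbours-⊂ {S} {v} {w} c =
    (λ x∈N → let x∈S , x≁w = ∈-nonNeighbours⁻ {S} {w} x∈N
             in ∈-nonNeighbours⁺ {S} {v} x∈S (contraposeᵇ (dominates _ x∈S) x≁w))
    , separator , ∈-nonNeighbours⁺ {S} {v} separator∈S separator≁v
    , λ sep∈N → true≢false (trans (sym separator~w) (proj₂ (∈-nonNeighbours⁻ {S} {w} sep∈N)))
    where open StrictlyCorners c

  dominatedBySurvivor : ∀ {S w} → S w ≡ true → ∃ λ w' → removeCorners G S w' ≡ true × Dominates S w w'
  dominatedBySurvivor {S} {w} w∈S = go w∈S (<-wellFounded ∣ nonNeighbours S w ∣)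
    where
    go : ∀ {w} → S w ≡ true → Acc _<_ ∣ nonNeighbours S w ∣ →
         ∃ λ w' → removeCorners G S w' ≡ true × Dominates S w w'
    go {w} w∈S (acc smaller) with isStrictCorner G S w in corner?
    ... | false = w , removeCorners-true⁺ {S} w∈S corner? , Dominates-refl
    ... | true with w₁ , c ← isStrictCorner-true⁻ corner?
               with w' , w'-survives , w₁⊑w'
                      ← go (StrictlyCorners.w∈S c) (smaller (p⊂q⇒∣p∣<∣q∣ (StrictlyCorners⇒nonNeighbours-⊂ {S} c)))
                    = w' , w'-survives , Dominates-trans (StrictlyCorners.dominates c) w₁⊑w'

  StrictlyCorners-extend : ∀ {S u w w'} → StrictlyCorners S u w → S w' ≡ true → u ≢ w' →
                           Dominates S w w' → StrictlyCorners S u w'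
  StrictlyCorners-extend c w'∈S u≢w' w⊑w' = record
    { v∈S = v∈S ; w∈S = w'∈S ; v≢w = u≢w'
    ; dominates = Dominates-trans dominates w⊑w'
    ; separator = separator ; separator∈S = separator∈S
    ; separator~w = w⊑w' separator separator∈S separator~w
    ; separator≁v = separator≁v
    }
    where open StrictlyCorners c

  -- For k ≥ 1, f G k is step (Gk G k) by the definition of Gk.
  step : Sub G → V G → Sub G
  step S u w = removeCorners G S w ∧ (if removeCorners G S u then ⌊ u ≟ w ⌋ else corners G S u w)

  step-nonempty : ∀ {S u} → S u ≡ true → ∃ λ w → step S u w ≡ true
  step-nonempty {S} {u} u∈S with removeCorners G S u in survives
  ... | true  = u , ∧-true⁺ survives (≟-refl u)
  ... | false
    with w , c ← isStrictCorner-true⁻ (removeCorners-false⁻ {S} u∈S survives)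
    with w' , w'-survives , w⊑w' ← dominatedBySurvivor {S} (StrictlyCorners.w∈S c)
    = w' , ∧-true⁺ w'-survives (StrictlyCorners⇒corners
             (StrictlyCorners-extend c (removeCorners-true⁻ {S} w'-survives) u≢w' w⊑w'))
    where
    u≢w' : u ≢ w'
    u≢w' refl = true≢false (trans (sym w'-survives) survives)

  step-dominates : ∀ {S u u*} → step S u u* ≡ true → Dominates S u u*
  step-dominates {S} {u} {u*} h with removeCorners G S u
  ... | true with refl ← ≟-true⁻ (proj₂ (∧-true⁻ (removeCorners G S u*) h)) = Dominates-refl
  ... | false = StrictlyCorners.dominates (corners⇒StrictlyCorners (proj₂ (∧-true⁻ (removeCorners G S u*) h)))

  step-isHom : ∀ S → IsHom G S (removeCorners G S) (step S)
  step-isHom S =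
      (λ _ → step-nonempty {S})
    , (λ u _ w h → proj₁ (∧-true⁻ (removeCorners G S w) h))
    , λ u v u∈S _ u~v u* v* hu hv →
        dominators-adjacent u∈S (removeCorners-true⁻ {S} (proj₁ (∧-true⁻ (removeCorners G S v*) hv)))
                            u~v (step-dominates {S} hu) (step-dominates {S} hv)

  _⊙_ : (V G → Sub G) → (V G → Sub G) → V G → Sub G
  (h₂ ⊙ h₁) u w = anyV G λ x → h₁ u x ∧ h₂ x w

  IsHom-⊙ : ∀ {A B C h₁ h₂} → IsHom G A B h₁ → IsHom G B C h₂ → IsHom G A C (h₂ ⊙ h₁)
  IsHom-⊙ {A} {C = C} {h₁} {h₂} (nonempty₁ , into₁ , adj₁) (nonempty₂ , into₂ , adj₂) =
    nonempty , into , adjacent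
    where
    nonempty : ∀ u → A u ≡ true → ∃ λ w → (h₂ ⊙ h₁) u w ≡ true
    nonempty u u∈A
      with x , ux ← nonempty₁ u u∈A
      with w , xw ← nonempty₂ x (into₁ u u∈A x ux)
      = w , anyV-true⁺ x (∧-true⁺ ux xw)

    into : ∀ u → A u ≡ true → ∀ w → (h₂ ⊙ h₁) u w ≡ true → C w ≡ true
    into u u∈A w h with x , uxw ← anyV-true⁻ h =
      let ux , xw = ∧-true⁻ (h₁ u x) uxw in into₂ x (into₁ u u∈A x ux) w xw

    adjacent : ∀ u v → A u ≡ true → A v ≡ true → adj u v ≡ true → ∀ u* v* →
               (h₂ ⊙ h₁) u u* ≡ true → (h₂ ⊙ h₁) v v* ≡ true → adj u* v* ≡ true
    adjacent u v u∈A v∈A u~v u* v* hu hv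
      with x , uxu* ← anyV-true⁻ hu | y , vyv* ← anyV-true⁻ hv =
      let ux , xu* = ∧-true⁻ (h₁ u x) uxu*
          vy , yv* = ∧-true⁻ (h₁ v y) vyv*
      in adj₂ x y (into₁ u u∈A x ux) (into₁ v v∈A y vy) (adj₁ u v u∈A v∈A u~v x y ux vy)
              u* v* xu* yv*

  IsHom-identity : ∀ H → IsHom G H H (λ u w → ⌊ u ≟ w ⌋)
  IsHom-identity H =
      (λ u _ → u , ≟-refl u)
    , (λ _ u∈H _ h → subst (λ x → H x ≡ true) (≟-true⁻ h) u∈H)
    , λ _ _ _ _ u~v _ _ hu hv → subst₂ (λ x y → adj x y ≡ true) (≟-true⁻ hu) (≟-true⁻ hv) u~v

  F-isHom : ∀ i → IsHom G (full G) (Gk G (suc i)) (F G (suc i))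
  F-isHom zero    = IsHom-identity (full G)
  F-isHom (suc i) = IsHom-⊙ (F-isHom i) (step-isHom (Gk G (suc i)))

lemma3p4 : (G : Graph) (k : ℕ) → 1 ≤ k →
    (Gdef G (suc k) ≡ true → IsHom G (Gk G k) (Gk G (suc k)) (f G k))
    × (Gdef G k ≡ true → IsHom G (full G) (Gk G k) (F G k))
lemma3p4 G (suc i) _ = (λ _ → step-isHom G (Gk G (suc i))) , (λ _ → F-isHom G i)
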